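{- Let $n,k\in\mathbb{N}$ with $k\ge2$, set $B=n$, and let $f_j=1/j$ for $j\in[n]$. Let $h_1,\dots,h_k:[n]\to[B]$ be independent, truly (uniformly) random hash functions, and for $i\in[n]$ define $\tilde f_i=\min_{\ell\in[k]}\left(\sum_{j\in[n]}[h_\ell(j)=h_\ell(i)]\,f_j\right)$. Then for every $i\in[n]$, $\mathbb{E}[|\tilde f_i-f_i|]=O(1/n)$, with an absolute implied constant.
   Context: $[E]$ denotes the indicator of the event $E$. -}

module Defs where

open import Data.Nat using (ℕ; zero; suc)
open import Data.Fin using (Fin; zero; suc; toℕ; _≟_)
open import Data.Integer using (+_)
open import Data.Rational using (ℚ; 0ℚ; _+_; _*_; _-_; _⊓_; ∣_∣; _/_)
open import Relation.Nullary using (yes; no)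

-- 1/m as a rational (value 0 at m = 0, never used there)
inv : ℕ → ℚ
inv zero = 0ℚ
inv (suc m) = + 1 / suc m

sumFin : (B : ℕ) → (Fin B → ℚ) → ℚ
sumFin zero F = 0ℚ
sumFin (suc B) F = F zero + sumFin B (λ j → F (suc j))

avgFin : (B : ℕ) → (Fin B → ℚ) → ℚ
avgFin B F = sumFin B F * inv B

cons : {A : Set} {m : ℕ} → A → (Fin m → A) → Fin (suc m) → A
cons a g zero = a
cons a g (suc j) = g j

-- expectation over a function Fin m → A whose values are independent,
-- each distributed according to the expectation operator E
avgPi : (m : ℕ) {A : Set} → ((A → ℚ) → ℚ) → ((Fin m → A) → ℚ) → ℚ
avgPi zero E F = F (λ ())
avgPi (suc m) E F = E (λ a → avgPi m E (λ g → F (cons a g)))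

-- minimum over Fin k (value 0 for k = 0, never used since k ≥ 2)
minFin : (k : ℕ) → (Fin k → ℚ) → ℚ
minFin zero F = 0ℚ
minFin (suc zero) F = F zero
minFin (suc (suc k)) F = F zero ⊓ minFin (suc k) (λ j → F (suc j))

-- f_j = 1/j for j ∈ [n], with j ∈ [n] represented by Fin n (j ↦ toℕ j + 1)
freq : {n : ℕ} → Fin n → ℚ
freq j = inv (suc (toℕ j))

bucketTerm : {n : ℕ} → (Fin n → Fin n) → Fin n → Fin n → ℚ
bucketTerm h i j with h j ≟ h i
... | yes _ = freq j
... | no _ = 0ℚ

ftilde : {n k : ℕ} → (Fin k → Fin n → Fin n) → Fin n → ℚ
ftilde {n} {k} h i = minFin k (λ ℓ → sumFin n (λ j → bucketTerm (h ℓ) i j))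

expectedError : (n k : ℕ) → Fin n → ℚ
expectedError n k i =
  avgPi k (avgPi n (avgFin n)) (λ h → ∣ ftilde h i - freq i ∣)

-- The estimate never undercounts: the bucket of i under h_ℓ holds f_i plus the collision
-- mass T_ℓ = Σ_{j ≠ i} f_j [h_ℓ(j) = h_ℓ(i)], so f̃_i − f_i = min_ℓ T_ℓ ≤ min(T_1, T_2).
-- Splitting both sums, min(T_1, T_2) ≤ Σ_{j,m} min(f_j, f_m) X_1j X_2m with X_ℓj the collision
-- indicator. As h_1 and h_2 are independent and every X_ℓj has mean at most 1/n, the expected
-- error is at most n⁻² Σ_{j,m} min(f_j, f_m) ≤ 2/n, because min(1/j, 1/m) ≤ [m ≤ j]/j + [j ≤ m]/m
-- and at most j indices m satisfy m ≤ j.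

{-# OPTIONS --safe #-}
module Submission where

open import Defs
open import Data.Nat using (ℕ; _≤_)
open import Data.Fin using (Fin)
open import Data.Product using (∃)
open import Data.Rational using (ℚ; _*_)
import Data.Rational as Q

open import Data.Bool using (Bool; true; false)
open import Data.Fin using (zero; suc; toℕ; _≟_)
import Data.Integer as ℤ
import Data.Integer.Properties as ℤ
open import Data.Nat using (zero; suc; s≤s; z≤n; s≤s⁻¹)
import Data.Nat.Properties as ℕ
open import Data.Product using (_,_; _×_)
open import Data.Rational using (0ℚ; 1ℚ; _+_; _-_; -_; _⊓_; ∣_∣; toℚᵘ; nonNegative)
open import Data.Rational.Properties hiding (_≟_)
import Data.Rational.Solver as ℚ-Solver
import Data.Rational.Unnormalised as ℚᵘ
import Data.Rational.Unnormalised.Properties as ℚᵘ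
open import Data.Sum using (inj₁; inj₂)
open import Function using (_∘_)
open import Function.Bundles using (mk⇔)
open import Relation.Binary.PropositionalEquality
open import Relation.Nullary.Decidable using (Dec; yes; no; does; ¬?; _×-dec_; does-⇔; dec-true)
open import Relation.Nullary.Negation using (¬_; contradiction)

open ℚ-Solver.+-*-Solver using (solve; _:+_; _:-_; _:*_; _:=_; con)

𝟙 : Bool → ℚ
𝟙 true  = 1ℚ
𝟙 false = 0ℚ

𝟙[_] : {P : Set} → Dec P → ℚ
𝟙[ d ] = 𝟙 (does d)

fromℕ : ℕ → ℚ
fromℕ zero    = 0ℚ
fromℕ (suc n) = 1ℚ + fromℕ n

p*𝟙[yes]≡p : ∀ {P : Set} p (d : Dec P) → P → p * 𝟙[ d ] ≡ p
p*𝟙[yes]≡p p d x = trans (cong (λ b → p * 𝟙 b) (dec-true d x)) (*-identityʳ p)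

0≤𝟙[_] : {P : Set} (d : Dec P) → 0ℚ Q.≤ 𝟙[ d ]
0≤𝟙[ yes _ ] = nonNegative⁻¹ 1ℚ
0≤𝟙[ no _ ]  = ≤-refl

0≤fromℕ : ∀ n → 0ℚ Q.≤ fromℕ n
0≤fromℕ zero    = ≤-refl
0≤fromℕ (suc n) = +-mono-≤ (nonNegative⁻¹ 1ℚ) (0≤fromℕ n)

0≤inv : ∀ n → 0ℚ Q.≤ inv n
0≤inv zero    = ≤-refl
0≤inv (suc n) = nonNegative⁻¹ (inv (suc n)) {{normalize-nonNeg 1 (suc n)}}

0≤freq : ∀ {n} (j : Fin n) → 0ℚ Q.≤ freq j
0≤freq j = 0≤inv (suc (toℕ j))

fromℕ-toℚᵘ : ∀ n → toℚᵘ (fromℕ n) ℚᵘ.≃ ℚᵘ.mkℚᵘ (ℤ.+ n) 0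
fromℕ-toℚᵘ zero    = ℚᵘ.≃-refl
fromℕ-toℚᵘ (suc n) = ℚᵘ.≃-trans (toℚᵘ-homo-+ 1ℚ (fromℕ n))
  (ℚᵘ.≃-trans (ℚᵘ.+-congʳ ℚᵘ.1ℚᵘ (fromℕ-toℚᵘ n))
    (ℚᵘ.*≡* (cong (λ z → (ℤ.+ 1 ℤ.+ z) ℤ.* ℤ.+ 1) (ℤ.*-identityʳ (ℤ.+ n)))))

fromℕ*inv≡1 : ∀ n → fromℕ (suc n) * inv (suc n) ≡ 1ℚ
fromℕ*inv≡1 n = toℚᵘ-injective (ℚᵘ.≃-trans (toℚᵘ-homo-* (fromℕ (suc n)) (inv (suc n)))
  (ℚᵘ.≃-trans (ℚᵘ.*-cong (fromℕ-toℚᵘ (suc n)) (toℚᵘ-fromℚᵘ (ℚᵘ.mkℚᵘ (ℤ.+ 1) n)))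
    (ℚᵘ.*-inverseʳ (ℚᵘ.mkℚᵘ (ℤ.+ suc n) 0))))

module _ {p q : ℚ} where

  0≤p*q : 0ℚ Q.≤ p → 0ℚ Q.≤ q → 0ℚ Q.≤ p * q
  0≤p*q 0≤p 0≤q = nonNegative⁻¹ (p * q)
    {{nonNeg*nonNeg⇒nonNeg p {{nonNegative 0≤p}} q {{nonNegative 0≤q}}}}

  p≤p+q : 0ℚ Q.≤ q → p Q.≤ p + q
  p≤p+q 0≤q = subst (Q._≤ p + q) (+-identityʳ p) (+-monoʳ-≤ p 0≤q)

  p≤q+p : 0ℚ Q.≤ q → p Q.≤ q + p
  p≤q+p 0≤q = subst (Q._≤ q + p) (+-identityˡ p) (+-monoˡ-≤ p 0≤q)

  p≤q⇒0≤q-p : p Q.≤ q → 0ℚ Q.≤ q - p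
  p≤q⇒0≤q-p p≤q = subst (Q._≤ q - p) (+-inverseʳ p) (+-monoˡ-≤ (- p) p≤q)

  p≤q+r⇒p-r≤q : ∀ {r} → p Q.≤ q + r → p - r Q.≤ q
  p≤q+r⇒p-r≤q {r} p≤q+r = subst (p - r Q.≤_) q+r-r≡q (+-monoˡ-≤ (- r) p≤q+r)
    where
    q+r-r≡q : q + r - r ≡ q
    q+r-r≡q = solve 2 (λ q r → (q :+ r) :- r := q) refl q r

module _ {r p q : ℚ} (0≤r : 0ℚ Q.≤ r) where

  *-monoˡ-≤-0≤ : p Q.≤ q → r * p Q.≤ r * q
  *-monoˡ-≤-0≤ = *-monoˡ-≤-nonNeg r {{nonNegative 0≤r}}

  *-monoʳ-≤-0≤ : p Q.≤ q → p * r Q.≤ q * r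
  *-monoʳ-≤-0≤ = *-monoʳ-≤-nonNeg r {{nonNegative 0≤r}}

[p+q]⊓r≤p⊓r+q⊓r : ∀ {p q r} → 0ℚ Q.≤ p → 0ℚ Q.≤ q → 0ℚ Q.≤ r →
  (p + q) ⊓ r Q.≤ p ⊓ r + q ⊓ r
[p+q]⊓r≤p⊓r+q⊓r {p} {q} {r} 0≤p 0≤q 0≤r with ≤-total r p | ≤-total r q
... | inj₁ r≤p | _ = ≤-trans (p⊓q≤q (p + q) r)
  (subst (λ x → r Q.≤ x + q ⊓ r) (sym (p≥q⇒p⊓q≡q r≤p)) (p≤p+q (⊓-glb 0≤q 0≤r)))
... | inj₂ _ | inj₁ r≤q = ≤-trans (p⊓q≤q (p + q) r)
  (subst (λ x → r Q.≤ p ⊓ r + x) (sym (p≥q⇒p⊓q≡q r≤q)) (p≤q+p (⊓-glb 0≤p 0≤r)))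
... | inj₂ p≤r | inj₂ q≤r = ≤-trans (p⊓q≤p (p + q) r)
  (≤-reflexive (sym (cong₂ _+_ (p≤q⇒p⊓q≡p p≤r) (p≤q⇒p⊓q≡p q≤r))))

⊓-*𝟙-≤ : ∀ p q b c → (p * 𝟙 b) ⊓ (q * 𝟙 c) Q.≤ (p ⊓ q) * (𝟙 b * 𝟙 c)
⊓-*𝟙-≤ p q false c = ≤-trans (p⊓q≤p (p * 0ℚ) (q * 𝟙 c))
  (≤-reflexive (solve 3 (λ p m y → p :* con 0ℚ := m :* (con 0ℚ :* y)) refl p (p ⊓ q) (𝟙 c)))
⊓-*𝟙-≤ p q true false = ≤-trans (p⊓q≤q (p * 1ℚ) (q * 0ℚ))
  (≤-reflexive (solve 2 (λ q m → q :* con 0ℚ := m :* (con 1ℚ :* con 0ℚ)) refl q (p ⊓ q)))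
⊓-*𝟙-≤ p q true true = ≤-reflexive
  (trans (cong₂ _⊓_ (*-identityʳ p) (*-identityʳ q)) (sym (*-identityʳ (p ⊓ q))))

minFin-glb : ∀ k {c} (G : Fin (suc k) → ℚ) → (∀ ℓ → c Q.≤ G ℓ) → c Q.≤ minFin (suc k) G
minFin-glb zero    G c≤G = c≤G zero
minFin-glb (suc k) G c≤G = ⊓-glb (c≤G zero) (minFin-glb k (G ∘ suc) (c≤G ∘ suc))

minFin-≤ : ∀ k (G : Fin (suc k) → ℚ) ℓ → minFin (suc k) G Q.≤ G ℓ
minFin-≤ zero    G zero    = ≤-refl
minFin-≤ (suc k) G zero    = p⊓q≤p _ _
minFin-≤ (suc k) G (suc ℓ) =
  ≤-trans (p⊓q≤q (G zero) (minFin (suc k) (G ∘ suc))) (minFin-≤ k (G ∘ suc) ℓ)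

sumFin-cong : ∀ N {F G : Fin N → ℚ} → (∀ j → F j ≡ G j) → sumFin N F ≡ sumFin N G
sumFin-cong zero    F≡G = refl
sumFin-cong (suc N) F≡G = cong₂ _+_ (F≡G zero) (sumFin-cong N (F≡G ∘ suc))

sumFin-zero : ∀ N → sumFin N (λ _ → 0ℚ) ≡ 0ℚ
sumFin-zero zero    = refl
sumFin-zero (suc N) = trans (cong (0ℚ +_) (sumFin-zero N)) (+-identityˡ 0ℚ)

sumFin-+ : ∀ N (F G : Fin N → ℚ) → sumFin N (λ j → F j + G j) ≡ sumFin N F + sumFin N G
sumFin-+ zero    F G = refl
sumFin-+ (suc N) F G = begin
  (F zero + G zero) + sumFin N (λ j → F (suc j) + G (suc j))
    ≡⟨ cong ((F zero + G zero) +_) (sumFin-+ N (F ∘ suc) (G ∘ suc)) ⟩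
  (F zero + G zero) + (sumFin N (F ∘ suc) + sumFin N (G ∘ suc))
    ≡⟨ solve 4 (λ a b c d → (a :+ b) :+ (c :+ d) := (a :+ c) :+ (b :+ d)) refl
         (F zero) (G zero) (sumFin N (F ∘ suc)) (sumFin N (G ∘ suc)) ⟩
  (F zero + sumFin N (F ∘ suc)) + (G zero + sumFin N (G ∘ suc)) ∎
  where open ≡-Reasoning

sumFin-*ˡ : ∀ N c (F : Fin N → ℚ) → sumFin N (λ j → c * F j) ≡ c * sumFin N F
sumFin-*ˡ zero    c F = sym (*-zeroʳ c)
sumFin-*ˡ (suc N) c F =
  trans (cong (c * F zero +_) (sumFin-*ˡ N c (F ∘ suc))) (sym (*-distribˡ-+ c _ _))

sumFin-*ʳ : ∀ N c (F : Fin N → ℚ) → sumFin N (λ j → F j * c) ≡ sumFin N F * c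
sumFin-*ʳ N c F = begin
  sumFin N (λ j → F j * c) ≡⟨ sumFin-cong N (λ j → *-comm (F j) c) ⟩
  sumFin N (λ j → c * F j) ≡⟨ sumFin-*ˡ N c F ⟩
  c * sumFin N F           ≡⟨ *-comm c _ ⟩
  sumFin N F * c           ∎
  where open ≡-Reasoning

sumFin-const : ∀ N c → sumFin N (λ _ → c) ≡ fromℕ N * c
sumFin-const zero    c = sym (*-zeroˡ c)
sumFin-const (suc N) c = trans (cong (c +_) (sumFin-const N c))
  (solve 2 (λ c n → c :+ n :* c := (con 1ℚ :+ n) :* c) refl c (fromℕ N))

sumFin-swap : ∀ N M (F : Fin N → Fin M → ℚ) →
  sumFin N (λ j → sumFin M (F j)) ≡ sumFin M (λ m → sumFin N (λ j → F j m))
sumFin-swap zero    M F = sym (sumFin-zero M)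
sumFin-swap (suc N) M F = trans (cong (sumFin M (F zero) +_) (sumFin-swap N M (F ∘ suc)))
  (sym (sumFin-+ M (F zero) (λ m → sumFin N (λ j → F (suc j) m))))

sumFin-𝟙≟ : ∀ N (x : Fin N) (F : Fin N → ℚ) → sumFin N (λ y → 𝟙[ y ≟ x ] * F y) ≡ F x
sumFin-𝟙≟ (suc N) zero F = begin
  1ℚ * F zero + sumFin N (λ y → 0ℚ * F (suc y))
    ≡⟨ cong₂ _+_ (*-identityˡ (F zero))
                 (trans (sumFin-cong N (λ y → *-zeroˡ (F (suc y)))) (sumFin-zero N)) ⟩
  F zero + 0ℚ ≡⟨ +-identityʳ (F zero) ⟩
  F zero      ∎
  where open ≡-Reasoning
sumFin-𝟙≟ (suc N) (suc x) F =
  trans (cong₂ _+_ (*-zeroˡ (F zero)) (sumFin-𝟙≟ N x (F ∘ suc))) (+-identityˡ (F (suc x)))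

sumFin-mono : ∀ N {F G : Fin N → ℚ} → (∀ j → F j Q.≤ G j) → sumFin N F Q.≤ sumFin N G
sumFin-mono zero    F≤G = ≤-refl
sumFin-mono (suc N) F≤G = +-mono-≤ (F≤G zero) (sumFin-mono N (F≤G ∘ suc))

0≤sumFin : ∀ N {F : Fin N → ℚ} → (∀ j → 0ℚ Q.≤ F j) → 0ℚ Q.≤ sumFin N F
0≤sumFin N {F} 0≤F = subst (Q._≤ sumFin N F) (sumFin-zero N) (sumFin-mono N 0≤F)

sumFin-⊓-≤ : ∀ N (F : Fin N → ℚ) {r} → (∀ j → 0ℚ Q.≤ F j) → 0ℚ Q.≤ r →
  sumFin N F ⊓ r Q.≤ sumFin N (λ j → F j ⊓ r)
sumFin-⊓-≤ zero    F {r} 0≤F 0≤r = p⊓q≤p 0ℚ r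
sumFin-⊓-≤ (suc N) F 0≤F 0≤r =
  ≤-trans ([p+q]⊓r≤p⊓r+q⊓r (0≤F zero) (0≤sumFin N (0≤F ∘ suc)) 0≤r)
    (+-monoʳ-≤ (F zero ⊓ _) (sumFin-⊓-≤ N (F ∘ suc) (0≤F ∘ suc) 0≤r))

sumFin-⊓-sumFin-≤ : ∀ N M (F : Fin N → ℚ) (G : Fin M → ℚ) →
  (∀ j → 0ℚ Q.≤ F j) → (∀ m → 0ℚ Q.≤ G m) →
  sumFin N F ⊓ sumFin M G Q.≤ sumFin N (λ j → sumFin M (λ m → F j ⊓ G m))
sumFin-⊓-sumFin-≤ N M F G 0≤F 0≤G =
  ≤-trans (sumFin-⊓-≤ N F 0≤F (0≤sumFin M 0≤G)) (sumFin-mono N (λ j →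
    subst₂ Q._≤_ (⊓-comm _ (F j)) (sumFin-cong M (λ m → ⊓-comm (G m) (F j)))
      (sumFin-⊓-≤ M G 0≤G (0≤F j))))

record IsExpectation {A : Set} (E : (A → ℚ) → ℚ) : Set where
  field
    E-cong  : ∀ {F G : A → ℚ} → (∀ a → F a ≡ G a) → E F ≡ E G
    E-mono  : ∀ {F G : A → ℚ} → (∀ a → F a Q.≤ G a) → E F Q.≤ E G
    E-const : ∀ c → E (λ _ → c) ≡ c
    E-+     : ∀ (F G : A → ℚ) → E (λ a → F a + G a) ≡ E F + E G
    E-*ˡ    : ∀ c (F : A → ℚ) → E (λ a → c * F a) ≡ c * E F

avgFin-isExpectation : ∀ n → IsExpectation (avgFin (suc n))
avgFin-isExpectation n = record
  { E-cong  = λ F≡G → cong (_* r) (sumFin-cong s F≡G)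
  ; E-mono  = λ F≤G → *-monoʳ-≤-0≤ (0≤inv s) (sumFin-mono s F≤G)
  ; E-const = λ c → trans (cong (_* r) (sumFin-const s c))
      (trans (solve 3 (λ n c r → (n :* c) :* r := (n :* r) :* c) refl (fromℕ s) c r)
        (trans (cong (_* c) (fromℕ*inv≡1 n)) (*-identityˡ c)))
  ; E-+     = λ F G → trans (cong (_* r) (sumFin-+ s F G)) (*-distribʳ-+ r (sumFin s F) (sumFin s G))
  ; E-*ˡ    = λ c F → trans (cong (_* r) (sumFin-*ˡ s c F)) (*-assoc c _ r)
  }
  where
  s = suc n
  r = inv s

module _ {A : Set} {E : (A → ℚ) → ℚ} (isE : IsExpectation E) where
  open IsExpectation

  avgPi-isExpectation : ∀ m → IsExpectation (avgPi m E)
  avgPi-isExpectation zero = record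
    { E-cong  = λ F≡G → F≡G _
    ; E-mono  = λ F≤G → F≤G _
    ; E-const = λ _ → refl
    ; E-+     = λ _ _ → refl
    ; E-*ˡ    = λ _ _ → refl
    }
  avgPi-isExpectation (suc m) = record
    { E-cong  = λ F≡G → E-cong isE (λ a → E-cong ih (λ g → F≡G (cons a g)))
    ; E-mono  = λ F≤G → E-mono isE (λ a → E-mono ih (λ g → F≤G (cons a g)))
    ; E-const = λ c → trans (E-cong isE (λ _ → E-const ih c)) (E-const isE c)
    ; E-+     = λ F G → trans (E-cong isE (λ a → E-+ ih (F ∘ cons a) (G ∘ cons a))) (E-+ isE _ _)
    ; E-*ˡ    = λ c F → trans (E-cong isE (λ a → E-*ˡ ih c (F ∘ cons a))) (E-*ˡ isE c _)
    }
    where ih = avgPi-isExpectation m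

  avgPi-marginal : ∀ m (p : Fin m) (φ : A → ℚ) → avgPi m E (λ g → φ (g p)) ≡ E φ
  avgPi-marginal (suc m) zero    φ = E-cong isE (λ a → E-const (avgPi-isExpectation m) (φ a))
  avgPi-marginal (suc m) (suc p) φ = trans (E-cong isE (λ _ → avgPi-marginal m p φ)) (E-const isE _)

  avgPi-pair : (ψ : A → A → ℚ) → (∀ x y → ψ x y ≡ ψ y x) → ∀ m (p q : Fin m) → ¬ p ≡ q →
    avgPi m E (λ g → ψ (g p) (g q)) ≡ E (λ x → E (ψ x))
  avgPi-pair ψ ψ-sym (suc m) zero    zero    p≢q = contradiction refl p≢q
  avgPi-pair ψ ψ-sym (suc m) zero    (suc q) p≢q = E-cong isE (λ a → avgPi-marginal m q (ψ a))
  avgPi-pair ψ ψ-sym (suc m) (suc p) zero    p≢q =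
    E-cong isE (λ a → trans (avgPi-marginal m p (λ x → ψ x a)) (E-cong isE (λ y → ψ-sym y a)))
  avgPi-pair ψ ψ-sym (suc m) (suc p) (suc q) p≢q =
    trans (E-cong isE (λ _ → avgPi-pair ψ ψ-sym m p q (p≢q ∘ cong suc))) (E-const isE _)

  avgPi-mono-first-two : ∀ k {F : (Fin (suc (suc k)) → A) → ℚ} (G : A → A → ℚ) →
    (∀ h → F h Q.≤ G (h zero) (h (suc zero))) → avgPi (suc (suc k)) E F Q.≤ E (λ a → E (G a))
  avgPi-mono-first-two k G F≤G = E-mono isE (λ a → E-mono isE (λ b →
    ≤-trans (E-mono (avgPi-isExpectation k) (λ g → F≤G (cons a (cons b g))))
            (≤-reflexive (E-const (avgPi-isExpectation k) (G a b)))))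

module _ {A : Set} {E : (A → ℚ) → ℚ} (isE : IsExpectation E) where
  open IsExpectation isE
  open ≡-Reasoning

  0≤E : ∀ {F} → (∀ a → 0ℚ Q.≤ F a) → 0ℚ Q.≤ E F
  0≤E {F} 0≤F = subst (Q._≤ E F) (E-const 0ℚ) (E-mono 0≤F)

  E-sumFin : ∀ N (F : A → Fin N → ℚ) →
    E (λ a → sumFin N (F a)) ≡ sumFin N (λ j → E (λ a → F a j))
  E-sumFin zero    F = E-const 0ℚ
  E-sumFin (suc N) F = trans (E-+ (λ a → F a zero) (λ a → sumFin N (F a ∘ suc)))
    (cong (E (λ a → F a zero) +_) (E-sumFin N (λ a → F a ∘ suc)))

  E-sumFin² : ∀ N (F : A → Fin N → Fin N → ℚ) →
    E (λ a → sumFin N (λ j → sumFin N (F a j))) ≡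
    sumFin N (λ j → sumFin N (λ m → E (λ a → F a j m)))
  E-sumFin² N F = trans (E-sumFin N _) (sumFin-cong N (λ j → E-sumFin N (λ a → F a j)))

  E-independent-* : ∀ (F G : A → ℚ) → E (λ a → E (λ b → F a * G b)) ≡ E F * E G
  E-independent-* F G = begin
    E (λ a → E (λ b → F a * G b)) ≡⟨ E-cong (λ a → trans (E-*ˡ (F a) G) (*-comm (F a) (E G))) ⟩
    E (λ a → E G * F a)           ≡⟨ E-*ˡ (E G) F ⟩
    E G * E F                     ≡⟨ *-comm (E G) (E F) ⟩
    E F * E G                     ∎

  E-bilinear : ∀ N (c : Fin N → Fin N → ℚ) (X : A → Fin N → ℚ) →
    E (λ a → E (λ b → sumFin N (λ j → sumFin N (λ m → c j m * (X a j * X b m))))) ≡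
    sumFin N (λ j → sumFin N (λ m → c j m * (E (λ a → X a j) * E (λ b → X b m))))
  E-bilinear N c X = begin
    E (λ a → E (λ b → sumFin N (λ j → sumFin N (λ m → c j m * (X a j * X b m)))))
      ≡⟨ E-cong (λ a → E-sumFin² N (λ b j m → c j m * (X a j * X b m))) ⟩
    E (λ a → sumFin N (λ j → sumFin N (λ m → E (λ b → c j m * (X a j * X b m)))))
      ≡⟨ E-sumFin² N _ ⟩
    sumFin N (λ j → sumFin N (λ m → E (λ a → E (λ b → c j m * (X a j * X b m)))))
      ≡⟨ sumFin-cong N (λ j → sumFin-cong N (λ m →
           trans (E-cong (λ a → E-*ˡ (c j m) _))
             (trans (E-*ˡ (c j m) _) (cong (c j m *_) (E-independent-* (λ a → X a j) (λ b → X b m)))))) ⟩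
    sumFin N (λ j → sumFin N (λ m → c j m * (E (λ a → X a j) * E (λ b → X b m)))) ∎

  E-bilinear-≤ : ∀ N (c : Fin N → Fin N → ℚ) (X : A → Fin N → ℚ) {r} →
    (∀ j m → 0ℚ Q.≤ c j m) → (∀ a j → 0ℚ Q.≤ X a j) → (∀ j → E (λ a → X a j) Q.≤ r) →
    E (λ a → E (λ b → sumFin N (λ j → sumFin N (λ m → c j m * (X a j * X b m))))) Q.≤
    sumFin N (λ j → sumFin N (c j)) * (r * r)
  E-bilinear-≤ N c X {r} 0≤c 0≤X EX≤r = ≤-trans (≤-reflexive (E-bilinear N c X))
    (≤-trans (sumFin-mono N (λ j → sumFin-mono N (λ m → *-monoˡ-≤-0≤ (0≤c j m) (EX*EX≤r*r j m))))
      (≤-reflexive (trans (sumFin-cong N (λ j → sumFin-*ʳ N (r * r) (c j))) (sumFin-*ʳ N (r * r) _))))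
    where
    0≤EX : ∀ j → 0ℚ Q.≤ E (λ a → X a j)
    0≤EX j = 0≤E (λ a → 0≤X a j)
    EX*EX≤r*r : ∀ j m → E (λ a → X a j) * E (λ b → X b m) Q.≤ r * r
    EX*EX≤r*r j m = ≤-trans (*-monoʳ-≤-0≤ (0≤EX m) (EX≤r j))
      (*-monoˡ-≤-0≤ (≤-trans (0≤EX j) (EX≤r j)) (EX≤r m))

uniformHash-isExpectation : ∀ n → IsExpectation (avgPi (suc n) (avgFin (suc n)))
uniformHash-isExpectation n = avgPi-isExpectation (avgFin-isExpectation n) (suc n)

avgFin-𝟙≟ : ∀ n (x : Fin (suc n)) → avgFin (suc n) (λ y → 𝟙[ y ≟ x ]) ≡ inv (suc n)
avgFin-𝟙≟ n x = trans
  (cong (_* inv (suc n)) (trans (sumFin-cong (suc n) (λ y → sym (*-identityʳ 𝟙[ y ≟ x ])))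
                                (sumFin-𝟙≟ (suc n) x (λ _ → 1ℚ))))
  (*-identityˡ (inv (suc n)))

avgPi-collision : ∀ n {m} (p q : Fin m) → ¬ p ≡ q →
  avgPi m (avgFin (suc n)) (λ h → 𝟙[ h q ≟ h p ]) ≡ inv (suc n)
avgPi-collision n {m} p q p≢q = begin
  avgPi m U (λ h → 𝟙[ h q ≟ h p ]) ≡⟨ avgPi-pair isU (λ x y → 𝟙[ y ≟ x ]) 𝟙≟-sym m p q p≢q ⟩
  U (λ x → U (λ y → 𝟙[ y ≟ x ]))  ≡⟨ E-cong isU (avgFin-𝟙≟ n) ⟩
  U (λ _ → inv (suc n))            ≡⟨ E-const isU (inv (suc n)) ⟩
  inv (suc n)                      ∎
  where
  open ≡-Reasoning
  open IsExpectation
  U = avgFin (suc n)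
  isU = avgFin-isExpectation n
  𝟙≟-sym : ∀ x y → 𝟙[ y ≟ x ] ≡ 𝟙[ x ≟ y ]
  𝟙≟-sym x y = cong 𝟙 (does-⇔ (mk⇔ sym sym) (y ≟ x) (x ≟ y))

collision? : ∀ {n} (h : Fin n → Fin n) (i j : Fin n) → Dec (¬ j ≡ i × h j ≡ h i)
collision? h i j = ¬? (j ≟ i) ×-dec (h j ≟ h i)

collisionMass : ∀ {n} → (Fin n → Fin n) → Fin n → ℚ
collisionMass {n} h i = sumFin n (λ j → freq j * 𝟙[ collision? h i j ])

0≤collisionMass : ∀ {n} (h : Fin n → Fin n) i → 0ℚ Q.≤ collisionMass h i
0≤collisionMass {n} h i = 0≤sumFin n (λ j → 0≤p*q (0≤freq j) 0≤𝟙[ collision? h i j ])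

bucketTerm≡ : ∀ {n} (h : Fin n → Fin n) (i j : Fin n) →
  bucketTerm h i j ≡ freq j * 𝟙[ collision? h i j ] + 𝟙[ j ≟ i ] * freq j
bucketTerm≡ h i j with j ≟ i | h j ≟ h i
... | yes refl | yes _   = solve 1 (λ f → f := f :* con 0ℚ :+ con 1ℚ :* f) refl (freq j)
... | yes refl | no hi≢hi = contradiction refl hi≢hi
... | no _     | yes _   = solve 1 (λ f → f := f :* con 1ℚ :+ con 0ℚ :* f) refl (freq j)
... | no _     | no _    = solve 1 (λ f → con 0ℚ := f :* con 0ℚ :+ con 0ℚ :* f) refl (freq j)

bucketSum≡ : ∀ {n} (h : Fin n → Fin n) (i : Fin n) →
  sumFin n (bucketTerm h i) ≡ collisionMass h i + freq i
bucketSum≡ {n} h i =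
  trans (sumFin-cong n (bucketTerm≡ h i))
    (trans (sumFin-+ n (λ j → freq j * 𝟙[ collision? h i j ]) (λ j → 𝟙[ j ≟ i ] * freq j))
      (cong (collisionMass h i +_) (sumFin-𝟙≟ n i freq)))

ftilde-error-≤ : ∀ {n k} (h : Fin (suc (suc k)) → Fin n → Fin n) (i : Fin n) →
  ∣ ftilde h i - freq i ∣ Q.≤ collisionMass (h zero) i ⊓ collisionMass (h (suc zero)) i
ftilde-error-≤ {n} {k} h i =
  subst (Q._≤ collisionMass (h zero) i ⊓ collisionMass (h (suc zero)) i)
    (sym (0≤p⇒∣p∣≡p (p≤q⇒0≤q-p freq≤ftilde)))
    (⊓-glb (ftilde-freq≤collisionMass zero) (ftilde-freq≤collisionMass (suc zero)))
  where
  S : Fin (suc (suc k)) → ℚ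
  S ℓ = sumFin n (bucketTerm (h ℓ) i)
  freq≤ftilde : freq i Q.≤ ftilde h i
  freq≤ftilde = minFin-glb (suc k) S (λ ℓ →
    subst (freq i Q.≤_) (sym (bucketSum≡ (h ℓ) i)) (p≤q+p (0≤collisionMass (h ℓ) i)))
  ftilde-freq≤collisionMass : ∀ ℓ → ftilde h i - freq i Q.≤ collisionMass (h ℓ) i
  ftilde-freq≤collisionMass ℓ =
    p≤q+r⇒p-r≤q (≤-trans (minFin-≤ (suc k) S ℓ) (≤-reflexive (bucketSum≡ (h ℓ) i)))

collisionMass-⊓-≤ : ∀ {n} (a b : Fin n → Fin n) (i : Fin n) →
  collisionMass a i ⊓ collisionMass b i Q.≤
  sumFin n (λ j → sumFin n (λ m → (freq j ⊓ freq m) * (𝟙[ collision? a i j ] * 𝟙[ collision? b i m ])))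
collisionMass-⊓-≤ {n} a b i =
  ≤-trans (sumFin-⊓-sumFin-≤ n n _ _ (λ j → 0≤p*q (0≤freq j) 0≤𝟙[ collision? a i j ])
                                     (λ m → 0≤p*q (0≤freq m) 0≤𝟙[ collision? b i m ]))
    (sumFin-mono n (λ j → sumFin-mono n (λ m →
      ⊓-*𝟙-≤ (freq j) (freq m) (does (collision? a i j)) (does (collision? b i m)))))

avgPi-collision?-≤ : ∀ n (i j : Fin (suc n)) →
  avgPi (suc n) (avgFin (suc n)) (λ h → 𝟙[ collision? h i j ]) Q.≤ inv (suc n)
-- Splitting on j ≟ i makes collision? h i j compute.
avgPi-collision?-≤ n i j with j ≟ i
... | yes refl =
  ≤-trans (≤-reflexive (IsExpectation.E-const (uniformHash-isExpectation n) 0ℚ)) (0≤inv (suc n))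
... | no j≢i   = ≤-reflexive (avgPi-collision n i j (j≢i ∘ sym))

freq⊓freq-≤ : ∀ {N} (j m : Fin N) →
  freq j ⊓ freq m Q.≤ freq j * 𝟙[ toℕ m ℕ.≤? toℕ j ] + freq m * 𝟙[ toℕ j ℕ.≤? toℕ m ]
freq⊓freq-≤ j m with ℕ.≤-total (toℕ m) (toℕ j)
... | inj₁ m≤j = ≤-trans (p⊓q≤p (freq j) (freq m))
  (≤-trans (≤-reflexive (sym (p*𝟙[yes]≡p (freq j) (toℕ m ℕ.≤? toℕ j) m≤j)))
    (p≤p+q (0≤p*q (0≤freq m) 0≤𝟙[ toℕ j ℕ.≤? toℕ m ])))
... | inj₂ j≤m = ≤-trans (p⊓q≤q (freq j) (freq m))
  (≤-trans (≤-reflexive (sym (p*𝟙[yes]≡p (freq m) (toℕ j ℕ.≤? toℕ m) j≤m)))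
    (p≤q+p (0≤p*q (0≤freq j) 0≤𝟙[ toℕ m ℕ.≤? toℕ j ])))

sumFin-𝟙≤-count : ∀ N t → sumFin N (λ m → 𝟙[ toℕ m ℕ.≤? t ]) Q.≤ fromℕ (suc t)
sumFin-𝟙≤-count zero    t       = 0≤fromℕ (suc t)
sumFin-𝟙≤-count (suc N) zero    = ≤-reflexive (cong (1ℚ +_) (sumFin-zero N))
sumFin-𝟙≤-count (suc N) (suc t) = +-monoʳ-≤ 1ℚ (≤-trans
  (≤-reflexive (sumFin-cong N (λ m →
    cong 𝟙 (does-⇔ (mk⇔ s≤s⁻¹ s≤s) (suc (toℕ m) ℕ.≤? suc t) (toℕ m ℕ.≤? t)))))
  (sumFin-𝟙≤-count N t))

sumFin²-freq⊓freq-≤ : ∀ N →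
  sumFin N (λ j → sumFin N (λ m → freq j ⊓ freq m)) Q.≤ fromℕ N + fromℕ N
sumFin²-freq⊓freq-≤ N = begin
  sumFin N (λ j → sumFin N (λ m → freq j ⊓ freq m))
    ≤⟨ sumFin-mono N (λ j → sumFin-mono N (freq⊓freq-≤ j)) ⟩
  sumFin N (λ j → sumFin N (λ m → A j m + A m j))
    ≡⟨ trans (sumFin-cong N (λ j → sumFin-+ N (A j) (λ m → A m j))) (sumFin-+ N _ _) ⟩
  ΣΣA + sumFin N (λ j → sumFin N (λ m → A m j))
    ≡⟨ cong (ΣΣA +_) (sumFin-swap N N (λ j m → A m j)) ⟩
  ΣΣA + ΣΣA
    ≤⟨ +-mono-≤ ΣΣA≤N ΣΣA≤N ⟩
  fromℕ N + fromℕ N ∎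
  where
  open ≤-Reasoning
  A : Fin N → Fin N → ℚ
  A j m = freq j * 𝟙[ toℕ m ℕ.≤? toℕ j ]
  ΣΣA = sumFin N (λ j → sumFin N (A j))
  ΣΣA≤N : ΣΣA Q.≤ fromℕ N
  ΣΣA≤N = begin
    ΣΣA ≡⟨ sumFin-cong N (λ j → sumFin-*ˡ N (freq j) _) ⟩
    sumFin N (λ j → freq j * sumFin N (λ m → 𝟙[ toℕ m ℕ.≤? toℕ j ]))
      ≤⟨ sumFin-mono N (λ j → *-monoˡ-≤-0≤ (0≤freq j) (sumFin-𝟙≤-count N (toℕ j))) ⟩
    sumFin N (λ j → freq j * fromℕ (suc (toℕ j)))
      ≡⟨ sumFin-cong N (λ j → trans (*-comm (freq j) _) (fromℕ*inv≡1 (toℕ j))) ⟩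
    sumFin N (λ _ → 1ℚ) ≡⟨ trans (sumFin-const N 1ℚ) (*-identityʳ (fromℕ N)) ⟩
    fromℕ N ∎

2*fromℕ*inv²≡2*inv : ∀ n →
  (fromℕ (suc n) + fromℕ (suc n)) * (inv (suc n) * inv (suc n)) ≡ (1ℚ + 1ℚ) * inv (suc n)
2*fromℕ*inv²≡2*inv n = begin
  (x + x) * (r * r)     ≡⟨ solve 2 (λ x r → (x :+ x) :* (r :* r) := (x :* r :+ x :* r) :* r) refl x r ⟩
  (x * r + x * r) * r   ≡⟨ cong (λ y → (y + y) * r) (fromℕ*inv≡1 n) ⟩
  (1ℚ + 1ℚ) * r         ∎
  where
  open ≡-Reasoning
  x = fromℕ (suc n)
  r = inv (suc n)

expectedError-≤ : ∀ n k (i : Fin (suc n)) →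
  expectedError (suc n) (suc (suc k)) i Q.≤ (1ℚ + 1ℚ) * inv (suc n)
expectedError-≤ n k i = begin
  expectedError s (suc (suc k)) i
    ≤⟨ avgPi-mono-first-two isE k (λ a b → ΣΣ (λ j m → c j m * (X a j * X b m)))
         (λ h → ≤-trans (ftilde-error-≤ h i) (collisionMass-⊓-≤ (h zero) (h (suc zero)) i)) ⟩
  E (λ a → E (λ b → ΣΣ (λ j m → c j m * (X a j * X b m))))
    ≤⟨ E-bilinear-≤ isE s c X (λ j m → ⊓-glb (0≤freq j) (0≤freq m))
         (λ h j → 0≤𝟙[ collision? h i j ]) (avgPi-collision?-≤ n i) ⟩
  ΣΣ c * (r * r)
    ≤⟨ *-monoʳ-≤-0≤ (0≤p*q (0≤inv s) (0≤inv s)) (sumFin²-freq⊓freq-≤ s) ⟩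
  (fromℕ s + fromℕ s) * (r * r)
    ≡⟨ 2*fromℕ*inv²≡2*inv n ⟩
  (1ℚ + 1ℚ) * r ∎
  where
  open ≤-Reasoning
  s = suc n
  r = inv s
  E = avgPi s (avgFin s)
  isE = uniformHash-isExpectation n
  ΣΣ : (Fin s → Fin s → ℚ) → ℚ
  ΣΣ F = sumFin s (λ j → sumFin s (F j))
  c : Fin s → Fin s → ℚ
  c j m = freq j ⊓ freq m
  X : (Fin s → Fin s) → Fin s → ℚ
  X h j = 𝟙[ collision? h i j ]

lemma6 : ∃ λ (C : ℚ) → (n k : ℕ) → 2 ≤ k → (i : Fin n) →
           expectedError n k i Q.≤ C * inv n
lemma6 = 1ℚ + 1ℚ , bound
  where
  bound : (n k : ℕ) → 2 ≤ k → (i : Fin n) → expectedError n k i Q.≤ (1ℚ + 1ℚ) * inv n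
  bound (suc n) (suc (suc k)) (s≤s (s≤s z≤n)) i = expectedError-≤ n k i
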